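{- Let $G$ be a connected graph, and let $A, B$ be linked and convex subsets of $V(G)$. Then $A$ and $B$ are separable if and only if $\sigma(A,B)$ and $\sigma(B,A)$ are separable.
   Context: All graphs are finite, undirected and loopless. A chordless $uv$-path is a $uv$-path that is an induced subgraph. A set $C\subseteq V(G)$ is convex (monophonically convex) if for all $u,v\in C$ every vertex on a chordless $uv$-path lies in $C$; $\mathrm{cl}(X)$ is the intersection of all convex sets containing $X$. A half-space is a convex set $H$ with $V(G)\setminus H$ convex; $X,Y$ are separable if there is a half-space $H$ with $X\subseteq H$, $Y\subseteq V(G)\setminus H$. $A,B$ are linked if some vertex of $A$ is adjacent to some vertex of $B$. The shadow is $A/B = \{v\in V(G) : \mathrm{cl}(B\cup\{v\})\cap A\ne\emptyset\}$ (so $A/B = V(G)$ if $A\cap B\neq\emptyset$). A set $X\subseteq V(G)\setminus(A\cup B)$ is forbidden if $\mathrm{cl}(X)\cap A\ne\emptyset$ and $\mathrm{cl}(X)\cap B\ne\emptyset$; $\mathrm{mfs}(A,B)$ is the family of inclusion-minimal forbidden sets. $\sigma(A,B) = \mathrm{cl}\big(A/B\cup\bigcup\{\bigcap_{x\in X}\mathrm{cl}(A\cup\{x\}) : X\in\mathrm{mfs}(A,B)\}\big)$, and $\sigma(B,A)$ is defined symmetrically. -}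

module Defs where

open import Data.Nat using (ℕ; suc)
open import Data.Fin using (Fin; toℕ; fromℕ; zero)
open import Data.Fin.Subset using (Subset; _∈_; _∉_)
open import Data.Product using (Σ; _×_; ∃; ∃-syntax)
open import Data.Sum using (_⊎_)
open import Relation.Binary.PropositionalEquality using (_≡_)
open import Relation.Nullary using (¬_)
open import Function.Bundles using (_⇔_)
open import Function.Definitions using (Injective)
open import Level using (0ℓ)
open import Relation.Unary using (Pred)

record Graph (n : ℕ) : Set₁ where
  field
    Adj    : Fin n → Fin n → Set
    sym    : ∀ {u v} → Adj u v → Adj v u
    irrefl : ∀ {u} → ¬ Adj u u

VSet : ℕ → Set₁
VSet n = Pred (Fin n) 0ℓ

module _ {n : ℕ} (G : Graph n) where
  open Graph G

  Consec : ∀ {k} → Fin k → Fin k → Set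
  Consec i j = toℕ j ≡ suc (toℕ i) ⊎ toℕ i ≡ suc (toℕ j)

  record Walk (u v : Fin n) : Set where
    field
      len   : ℕ
      vtx   : Fin (suc len) → Fin n
      start : vtx zero ≡ u
      end   : vtx (fromℕ len) ≡ v
      step  : ∀ i j → Consec i j → Adj (vtx i) (vtx j)

  record ChordlessPath (u v : Fin n) : Set where
    field
      len     : ℕ
      vtx     : Fin (suc len) → Fin n
      start   : vtx zero ≡ u
      end     : vtx (fromℕ len) ≡ v
      distinct : Injective _≡_ _≡_ vtx
      induced : ∀ i j → Adj (vtx i) (vtx j) ⇔ Consec i j

  Connected : Set
  Connected = ∀ u v → Walk u v

  Convex : VSet n → Set
  Convex C = ∀ u v → C u → C v → (P : ChordlessPath u v) →
             ∀ i → C (ChordlessPath.vtx P i)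

  -- closure: intersection of all convex sets containing X
  -- (every subset of the finite set Fin n is represented by some Subset n)
  cl : VSet n → VSet n
  cl X w = (C : Subset n) → Convex (_∈ C) → (∀ x → X x → x ∈ C) → w ∈ C

  HalfSpace : Subset n → Set
  HalfSpace H = Convex (_∈ H) × Convex (_∉ H)

  Separable : VSet n → VSet n → Set
  Separable X Y = ∃[ H ] (HalfSpace H × (∀ x → X x → x ∈ H) × (∀ y → Y y → y ∉ H))

  Linked : VSet n → VSet n → Set
  Linked A B = ∃[ a ] ∃[ b ] (A a × B b × Adj a b)

  _∪_ : VSet n → VSet n → VSet n
  (X ∪ Y) w = X w ⊎ Y w

  ｛_｝ : Fin n → VSet n
  ｛ v ｝ w = w ≡ v

  Meets : VSet n → VSet n → Set
  Meets X Y = ∃[ w ] (X w × Y w)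

  shadow : VSet n → VSet n → VSet n
  shadow A B v = Meets (cl (B ∪ ｛ v ｝)) A

  Forbidden : VSet n → VSet n → Subset n → Set
  Forbidden A B X = (∀ x → x ∈ X → ¬ A x × ¬ B x)
                  × Meets (cl (_∈ X)) A × Meets (cl (_∈ X)) B

  MinForbidden : VSet n → VSet n → Subset n → Set
  MinForbidden A B X = Forbidden A B X ×
    ((Y : Subset n) → (∀ y → y ∈ Y → y ∈ X) → Forbidden A B Y → ∀ x → x ∈ X → x ∈ Y)

  σ : VSet n → VSet n → VSet n
  σ A B = cl (λ v → shadow A B v ⊎
                    ∃[ X ] (MinForbidden A B X × (∀ x → x ∈ X → cl (A ∪ ｛ x ｝) v)))

{-# OPTIONS --safe #-}
-- A half-space H with A ⊆ H and B ∩ H = ∅ already contains every generator of σ(A,B):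
-- a shadow vertex outside H would give cl(B ∪ {v}) ⊆ V ∖ H, which misses A; and a
-- forbidden X has some x ∈ X ∩ H (otherwise cl X ⊆ V ∖ H misses A), so that
-- cl(A ∪ {x}) ⊆ H.  Hence σ(A,B) ⊆ H, and symmetrically σ(B,A) ⊆ V ∖ H.  Conversely
-- A ⊆ σ(A,B) and B ⊆ σ(B,A).  Neither direction needs connectivity, convexity of A
-- and B, or linkedness.
module Submission where

open import Defs
open import Data.Nat using (ℕ)
open import Data.Fin.Properties using (any?)
open import Data.Fin.Subset using (Subset; _∈_; _∉_; ∁)
open import Data.Fin.Subset.Properties using (_∈?_; x∈∁p⇒x∉p; x∉p⇒x∈∁p; x∈p⇒x∉∁p; x∉∁p⇒x∈p)
open import Data.Product using (_,_; proj₁)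
open import Data.Sum using (inj₁; inj₂; [_,_])
open import Data.Empty using (⊥-elim)
open import Function using (_∘_)
open import Function.Bundles using (_⇔_; mk⇔)
open import Relation.Nullary using (¬_; yes; no)
open import Relation.Nullary.Decidable using (_×-dec_)
open import Relation.Unary using (_⊆′_; _≐′_)
open import Relation.Binary.PropositionalEquality using (refl)

module _ {n : ℕ} {G : Graph n} where

  cl-extensive : ∀ {X : VSet n} → X ⊆′ cl G X
  cl-extensive x Xx C _ X⊆C = X⊆C x Xx

  cl-least : ∀ {X : VSet n} (C : Subset n) → Convex G (_∈ C) → X ⊆′ (_∈ C) → cl G X ⊆′ (_∈ C)
  cl-least C convex-C X⊆C w clXw = clXw C convex-C X⊆C

  Convex-resp-≐ : ∀ {P Q : VSet n} → P ≐′ Q → Convex G P → Convex G Q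
  Convex-resp-≐ (P⊆Q , Q⊆P) convex-P u v Qu Qv path i =
    P⊆Q _ (convex-P u v (Q⊆P u Qu) (Q⊆P v Qv) path i)

  HalfSpace-∁ : ∀ {H : Subset n} → HalfSpace G H → HalfSpace G (∁ H)
  HalfSpace-∁ (convex-H , convex-H̄) =
    Convex-resp-≐ ((λ _ → x∉p⇒x∈∁p) , (λ _ → x∈∁p⇒x∉p)) convex-H̄ ,
    Convex-resp-≐ ((λ _ → x∈p⇒x∉∁p) , (λ _ → x∉∁p⇒x∈p)) convex-H

  Separable-mono : ∀ {X X′ Y Y′ : VSet n} → X′ ⊆′ X → Y′ ⊆′ Y →
                   Separable G X Y → Separable G X′ Y′
  Separable-mono X′⊆X Y′⊆Y (H , half , X⊆H , Y⊆H̄) =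
    H , half , (λ x → X⊆H x ∘ X′⊆X x) , (λ y → Y⊆H̄ y ∘ Y′⊆Y y)

  ⊆shadow : (A B : VSet n) → A ⊆′ shadow G A B
  ⊆shadow A B a Aa = a , cl-extensive a (inj₂ refl) , Aa

  ⊆σ : (A B : VSet n) → A ⊆′ σ G A B
  ⊆σ A B a Aa = cl-extensive a (inj₁ (⊆shadow A B a Aa))

  module _ {A B : VSet n} {H : Subset n} (half : HalfSpace G H)
           (A⊆H : A ⊆′ (_∈ H)) (B⊆H̄ : B ⊆′ (_∉ H)) where

    cl-outside-misses : ∀ {Y : VSet n} → Y ⊆′ (_∉ H) → ¬ Meets G (cl G Y) A
    cl-outside-misses Y⊆H̄ (w , clYw , Aw) =
      x∈∁p⇒x∉p (cl-least (∁ H) (proj₁ (HalfSpace-∁ half)) (λ y → x∉p⇒x∈∁p ∘ Y⊆H̄ y) w clYw)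
               (A⊆H w Aw)

    shadow⊆halfSpace : shadow G A B ⊆′ (_∈ H)
    shadow⊆halfSpace v meets with v ∈? H
    ... | yes v∈H = v∈H
    ... | no  v∉H = ⊥-elim (cl-outside-misses (λ w → [ B⊆H̄ w , (λ { refl → v∉H }) ]) meets)

    forbidden-hull⊆halfSpace : ∀ {X : Subset n} {v} → Meets G (cl G (_∈ X)) A →
                               (∀ x → x ∈ X → cl G (_∪_ G A (｛_｝ G x)) v) → v ∈ H
    forbidden-hull⊆halfSpace {X} meets v∈hulls with any? (λ x → (x ∈? X) ×-dec (x ∈? H))
    ... | yes (x , x∈X , x∈H) =
      cl-least H (proj₁ half) (λ _ → [ A⊆H _ , (λ { refl → x∈H }) ]) _ (v∈hulls x x∈X)
    ... | no  X∩H≡∅ = ⊥-elim (cl-outside-misses (λ x x∈X x∈H → X∩H≡∅ (x , x∈X , x∈H)) meets)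

    σ⊆halfSpace : σ G A B ⊆′ (_∈ H)
    σ⊆halfSpace = cl-least H (proj₁ half) λ
      { v (inj₁ v∈A/B) → shadow⊆halfSpace v v∈A/B
      ; v (inj₂ (X , ((_ , meets-A , _) , _) , v∈hulls)) → forbidden-hull⊆halfSpace meets-A v∈hulls
      }

  σ-Separable : ∀ {A B : VSet n} → Separable G A B → Separable G (σ G A B) (σ G B A)
  σ-Separable (H , half , A⊆H , B⊆H̄) =
    H , half , σ⊆halfSpace half A⊆H B⊆H̄ ,
    λ y → x∈∁p⇒x∉p ∘ σ⊆halfSpace (HalfSpace-∁ half)
                        (λ b → x∉p⇒x∈∁p ∘ B⊆H̄ b) (λ a → x∈p⇒x∉∁p ∘ A⊆H a) y

lemma9 : ∀ {n} (G : Graph n) → Connected G → (A B : VSet n) →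
         Convex G A → Convex G B → Linked G A B →
         Separable G A B ⇔ Separable G (σ G A B) (σ G B A)
lemma9 G _ A B _ _ _ = mk⇔ σ-Separable (Separable-mono (⊆σ A B) (⊆σ B A))
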